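{- Let $\Sigma$ be a finite alphabet, let $e$ be a regular expression over $\Sigma$ and let $w\in\Sigma^*$. Then $e \Downarrow w$ (that is, $w$ matches $e$) if and only if there is a finite run of the EKW machine \[ \langle e \,;\, [\,] \,;\, w\rangle \to \cdots \to \langle \varepsilon \,;\, [\,] \,;\, \epsilon_{\mathrm{str}}\rangle , \] where $\epsilon_{\mathrm{str}}$ denotes the empty string.
   Context: Regular expressions over a finite alphabet $\Sigma$ are given by the grammar $e ::= \varepsilon \mid a \mid e^{*} \mid e_1 e_2 \mid e_1 \mid e_2$ with $a\in\Sigma$; here $\varepsilon$ is a regular-expression constant (distinct from the empty string $\epsilon_{\mathrm{str}}$), and $e_1e_2$ is sequential composition. Strings are finite words over $\Sigma$, with concatenation written by juxtaposition. The matching relation $e \Downarrow w$ is the least relation closed under the rules: $a \Downarrow a$; $\varepsilon \Downarrow \epsilon_{\mathrm{str}}$; if $e_1\Downarrow w_1$ and $e_2\Downarrow w_2$ then $(e_1e_2)\Downarrow (w_1w_2)$; $e^{*}\Downarrow \epsilon_{\mathrm{str}}$; if $e\Downarrow w_1$ and $e^{*}\Downarrow w_2$ then $e^{*}\Downarrow (w_1w_2)$; if $e_1\Downarrow w$ then $(e_1\mid e_2)\Downarrow w$; if $e_2\Downarrow w$ then $(e_1\mid e_2)\Downarrow w$. Lists: $h::t$ is the list with head $h$ and tail $t$, $[\,]$ is the empty list. The EKW machine has configurations $\langle e\,;\,k\,;\,w\rangle$ where $e$ is a regular expression, $k$ is a list of regular expressions (the continuation) and $w$ is a string. Its (non-deterministic)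 transitions are exactly: $\langle e_1\mid e_2;k;w\rangle\to\langle e_1;k;w\rangle$; $\langle e_1\mid e_2;k;w\rangle\to\langle e_2;k;w\rangle$; $\langle e_1e_2;k;w\rangle\to\langle e_1;e_2::k;w\rangle$; $\langle e^{*};k;w\rangle\to\langle e;e^{*}::k;w\rangle$; $\langle e^{*};k;w\rangle\to\langle \varepsilon;k;w\rangle$; $\langle a;k;a\,w\rangle\to\langle \varepsilon;k;w\rangle$ for $a\in\Sigma$; $\langle \varepsilon;e::k;w\rangle\to\langle e;k;w\rangle$. A run is a finite sequence of zero or more such transitions. -}

module Defs where

open import Data.List using (List; []; _∷_; _++_)

-- Regular expressions over an alphabet Σ.
-- `ε` is the regular-expression constant; the empty string is [] : List Σ.
data RegExp (Σ : Set) : Set where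
  ε    : RegExp Σ
  chr  : Σ → RegExp Σ
  _*   : RegExp Σ → RegExp Σ
  _·_  : RegExp Σ → RegExp Σ → RegExp Σ
  _∣_  : RegExp Σ → RegExp Σ → RegExp Σ

Str : Set → Set
Str Σ = List Σ

data _⇓_ {Σ : Set} : RegExp Σ → Str Σ → Set where
  m-chr   : ∀ a → chr a ⇓ (a ∷ [])
  m-eps   : ε ⇓ []
  m-seq   : ∀ {e₁ e₂ w₁ w₂} → e₁ ⇓ w₁ → e₂ ⇓ w₂ → (e₁ · e₂) ⇓ (w₁ ++ w₂)
  m-star0 : ∀ {e} → (e *) ⇓ []
  m-star1 : ∀ {e w₁ w₂} → e ⇓ w₁ → (e *) ⇓ w₂ → (e *) ⇓ (w₁ ++ w₂)
  m-altl  : ∀ {e₁ e₂ w} → e₁ ⇓ w → (e₁ ∣ e₂) ⇓ w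
  m-altr  : ∀ {e₁ e₂ w} → e₂ ⇓ w → (e₁ ∣ e₂) ⇓ w

record Config (Σ : Set) : Set where
  constructor ⟨_︔_︔_⟩
  field
    exp  : RegExp Σ
    cont : List (RegExp Σ)
    str  : Str Σ

data _⟶_ {Σ : Set} : Config Σ → Config Σ → Set where
  t-altl : ∀ {e₁ e₂ k w} → ⟨ e₁ ∣ e₂ ︔ k ︔ w ⟩ ⟶ ⟨ e₁ ︔ k ︔ w ⟩
  t-altr : ∀ {e₁ e₂ k w} → ⟨ e₁ ∣ e₂ ︔ k ︔ w ⟩ ⟶ ⟨ e₂ ︔ k ︔ w ⟩
  t-seq  : ∀ {e₁ e₂ k w} → ⟨ e₁ · e₂ ︔ k ︔ w ⟩ ⟶ ⟨ e₁ ︔ e₂ ∷ k ︔ w ⟩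
  t-star : ∀ {e k w} → ⟨ e * ︔ k ︔ w ⟩ ⟶ ⟨ e ︔ (e *) ∷ k ︔ w ⟩
  t-skip : ∀ {e k w} → ⟨ e * ︔ k ︔ w ⟩ ⟶ ⟨ ε ︔ k ︔ w ⟩
  t-chr  : ∀ {a k w} → ⟨ chr a ︔ k ︔ a ∷ w ⟩ ⟶ ⟨ ε ︔ k ︔ w ⟩
  t-pop  : ∀ {e k w} → ⟨ ε ︔ e ∷ k ︔ w ⟩ ⟶ ⟨ e ︔ k ︔ w ⟩

data _⟶*_ {Σ : Set} : Config Σ → Config Σ → Set where
  done : ∀ {c} → c ⟶* c
  step : ∀ {c₁ c₂ c₃} → c₁ ⟶ c₂ → c₂ ⟶* c₃ → c₁ ⟶* c₃

module Submission where

-- Soundness of the machine w.r.t. matching (⇒) is proved by induction on the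
-- derivation of e ⇓ w₁, for an arbitrary continuation k and remaining input w₂:
-- the machine consumes w₁ while processing e and then returns to ⟨ ε ; k ; w₂ ⟩.
--
-- Completeness (⇐) uses the invariant "the configuration ⟨ e ; k ; w ⟩ is
-- accepting": w splits as w₁ ++ w₂ with e ⇓ w₁ and w₂ matched by the
-- continuation k read as a sequence of expressions (`_⇓ₖ_`).  The final
-- configuration is accepting, and every transition reflects the invariant
-- backwards, so every configuration that runs to the final one is accepting.

open import Defs
open import Data.Nat using (ℕ)
open import Data.Fin using (Fin)
open import Data.List using (List; []; _∷_; _++_)
open import Data.List.Properties using (++-assoc; ++-identityʳ)
open import Data.Product using (Σ-syntax; _×_; _,_)
open import Function.Bundles using (_↔_; _⇔_; mk⇔)
open import Relation.Binary.PropositionalEquality using (_≡_; refl; sym; trans; subst)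

data _⇓ₖ_ {A : Set} : List (RegExp A) → Str A → Set where
  k-nil  : [] ⇓ₖ []
  k-cons : ∀ {e k w₁ w₂} → e ⇓ w₁ → k ⇓ₖ w₂ → (e ∷ k) ⇓ₖ (w₁ ++ w₂)

Final : {A : Set} → Config A
Final = ⟨ ε ︔ [] ︔ [] ⟩

consume : {A : Set} {e : RegExp A} {k : List (RegExp A)} {w₁ w₂ : Str A} {c : Config A} →
          e ⇓ w₁ → ⟨ ε ︔ k ︔ w₂ ⟩ ⟶* c → ⟨ e ︔ k ︔ w₁ ++ w₂ ⟩ ⟶* c
consume (m-chr a) r = step t-chr r
consume m-eps     r = r
consume {w₂ = w} (m-seq {w₁ = u} {w₂ = v} m₁ m₂) r
  rewrite ++-assoc u v w = step t-seq (consume m₁ (step t-pop (consume m₂ r)))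
consume m-star0   r = step t-skip r
consume {w₂ = w} (m-star1 {w₁ = u} {w₂ = v} m₁ m₂) r
  rewrite ++-assoc u v w = step t-star (consume m₁ (step t-pop (consume m₂ r)))
consume (m-altl m) r = step t-altl (consume m r)
consume (m-altr m) r = step t-altr (consume m r)

Accepting : {A : Set} → Config A → Set
Accepting {A} ⟨ e ︔ k ︔ w ⟩ =
  Σ[ w₁ ∈ Str A ] Σ[ w₂ ∈ Str A ] (w ≡ w₁ ++ w₂) × e ⇓ w₁ × k ⇓ₖ w₂

final-accepting : {A : Set} → Accepting (Final {A})
final-accepting = [] , [] , refl , m-eps , k-nil

-- For t-seq and t-star the head of the continuation is folded
-- back into the expression; for t-pop it is unfolded.
accepting-backwards : {A : Set} {c d : Config A} → c ⟶ d → Accepting d → Accepting c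
accepting-backwards t-altl (w₁ , w₂ , eq , m , mk) = w₁ , w₂ , eq , m-altl m , mk
accepting-backwards t-altr (w₁ , w₂ , eq , m , mk) = w₁ , w₂ , eq , m-altr m , mk
accepting-backwards t-seq (w₁ , _ , refl , m , k-cons {w₁ = u} {w₂ = v} m₂ mk) =
  w₁ ++ u , v , sym (++-assoc w₁ u v) , m-seq m m₂ , mk
accepting-backwards t-star (w₁ , _ , refl , m , k-cons {w₁ = u} {w₂ = v} m₂ mk) =
  w₁ ++ u , v , sym (++-assoc w₁ u v) , m-star1 m m₂ , mk
accepting-backwards t-skip (.[] , w₂ , eq , m-eps , mk) = [] , w₂ , eq , m-star0 , mk
accepting-backwards (t-chr {a = a}) (.[] , w₂ , refl , m-eps , mk) =
  a ∷ [] , w₂ , refl , m-chr a , mk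
accepting-backwards t-pop (w₁ , w₂ , refl , m , mk) =
  [] , w₁ ++ w₂ , refl , m-eps , k-cons m mk

run-accepting : {A : Set} {c : Config A} → c ⟶* Final → Accepting c
run-accepting done       = final-accepting
run-accepting (step s r) = accepting-backwards s (run-accepting r)

accepting-empty : {A : Set} {e : RegExp A} {w : Str A} → Accepting ⟨ e ︔ [] ︔ w ⟩ → e ⇓ w
accepting-empty {e = e} (w₁ , .[] , eq , m , k-nil) =
  subst (e ⇓_) (sym (trans eq (++-identityʳ w₁))) m

theorem1 : (Σ : Set) (n : ℕ) → (Σ ↔ Fin n) → (e : RegExp Σ) (w : Str Σ) →
    (e ⇓ w) ⇔ (⟨ e ︔ [] ︔ w ⟩ ⟶* ⟨ ε ︔ [] ︔ [] ⟩)
theorem1 Σ n _ e w = mk⇔ matches⇒runs (λ r → accepting-empty (run-accepting r))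
  where
  matches⇒runs : e ⇓ w → ⟨ e ︔ [] ︔ w ⟩ ⟶* Final
  matches⇒runs m = subst (λ x → ⟨ e ︔ [] ︔ x ⟩ ⟶* Final) (++-identityʳ w) (consume m done)
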